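{- Let $G$ be a finite graph (loops and parallel edges allowed) with edge set $E$, and let $D\subseteq E$ be a double circuit of the bicircular matroid $B(G)$. Then the subgraph $G[D]$ has no leaves (vertices of degree $1$) and contains at most $4$ vertices of degree at least $3$. Moreover, each subdivision class of $G[D]$ is contained in a single class of the circuit partition of $D$.
   Context: $G[D]$ denotes the subgraph of $G$ with edge set $D$ and no isolated vertices. The bicircular matroid $B(G)$ is the matroid on $E$ whose independent sets are the edge sets $I\subseteq E$ such that every connected component of $G[I]$ contains at most one cycle; equivalently, its circuits are the edge sets of subgraphs that are subdivisions of two loops at the same vertex, two loops joined by an edge, or three parallel edges between two vertices. A double circuit of a matroid with rank function $r$ is a set $D$ with $r(D)=|D|-2$ and $r(D-d)=r(D)$ for every $d\in D$; its circuit partition is the unique (up to order) partition $(D_1,\dots,D_k)$ of $D$ such that the circuits contained in $D$ are exactly the sets $D\setminus D_i$. If a graph $H$ is obtained by subdividing edges of a graph $H_0$ of minimum degree at least $3$ ($H_0$ is unique up to isomorphism), the subdivision classes of $H$ are the sets of edges of $H$ arising from the subdivision of a single edge of $H_0$ (equivalently, for $H$ without leaves, the edge sets of the maximal paths whose internal vertices have degree $2$ in $H$). -}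

module Defs where

open import Data.Nat using (ℕ; zero; suc; _+_; _≤_; _≤?_)
open import Data.Bool using (Bool; true; false; if_then_else_)
open import Data.Fin using (Fin)
open import Data.Fin.Properties using (_≟_)
open import Data.Fin.Subset using (Subset; _∈_; _⊆_; _-_; ∣_∣)
open import Data.Vec using (lookup)
open import Data.List using (List; map; allFin; filter; length)
open import Data.Nat.ListAction using (sum)
open import Data.Product using (Σ; _×_; _,_; proj₁; proj₂; ∃; ∃-syntax)
open import Data.Sum using (_⊎_)
open import Data.Empty using (⊥)
open import Relation.Nullary using (¬_; does)
open import Relation.Binary.PropositionalEquality using (_≡_; _≢_)
open import Relation.Binary.Construct.Closure.ReflexiveTransitive using (Star)

record Graph (n m : ℕ) : Set where
  field
    ends : Fin m → Fin n × Fin n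

module _ {n m : ℕ} (G : Graph n m) where
  open Graph G

  private
    ind : {A : Set} → A → A → (Dec' : A → A → Bool) → ℕ
    ind a b d = if d a b then 1 else 0

    eqF : Fin n → Fin n → Bool
    eqF u v = does (u ≟ v)

  -- number of ends of edge e at vertex v (a loop contributes 2)
  endsAt : Fin m → Fin n → ℕ
  endsAt e v = ind v (proj₁ (ends e)) eqF + ind v (proj₂ (ends e)) eqF

  deg : Subset m → Fin n → ℕ
  deg D v = sum (map (λ e → if lookup D e then endsAt e v else 0) (allFin m))

  -- v is a vertex of G[D] (G[D] has no isolated vertices)
  IsVertex : Subset m → Fin n → Set
  IsVertex D v = 1 ≤ deg D v

  Adj : Subset m → Fin n → Fin n → Set
  Adj D u v = Σ (Fin m) λ e → e ∈ D × ((ends e ≡ (u , v)) ⊎ (ends e ≡ (v , u)))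

  Reach : Subset m → Fin n → Fin n → Set
  Reach D = Star (Adj D)

  Cycle : Subset m → Set
  Cycle C = (∃[ e ] e ∈ C)
          × (∀ v → IsVertex C v → deg C v ≡ 2)
          × (∀ u v → IsVertex C u → IsVertex C v → Reach C u v)

  -- independent in B(G): no connected component of G[I] contains two
  -- distinct cycles
  Independent : Subset m → Set
  Independent I = ∀ C₁ C₂ → C₁ ⊆ I → C₂ ⊆ I → Cycle C₁ → Cycle C₂ → C₁ ≢ C₂ →
                  ∀ u v → IsVertex C₁ u → IsVertex C₂ v → ¬ Reach I u v

  HasRank : Subset m → ℕ → Set
  HasRank X k = (Σ (Subset m) λ I → I ⊆ X × Independent I × ∣ I ∣ ≡ k)
              × (∀ I → I ⊆ X → Independent I → ∣ I ∣ ≤ k)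

  Circuit : Subset m → Set
  Circuit C = ¬ Independent C × (∀ e → e ∈ C → Independent (C - e))

  DoubleCircuit : Subset m → Set
  DoubleCircuit D = Σ ℕ λ k → HasRank D k × k + 2 ≡ ∣ D ∣
                    × (∀ d → d ∈ D → HasRank (D - d) k)

  IsCircuitPartition : Subset m → {k : ℕ} → (Fin k → Subset m) → Set
  IsCircuitPartition D {k} P =
      (∀ i → (∃[ e ] e ∈ P i) × P i ⊆ D)
    × (∀ e → e ∈ D → ∃[ i ] e ∈ P i)
    × (∀ i j e → e ∈ P i → e ∈ P j → i ≡ j)
    × (∀ C → (Circuit C × C ⊆ D) → ∃[ i ] C ≡ D Data.Fin.Subset.─ P i)
    × (∀ i → Circuit (D Data.Fin.Subset.─ P i))

  -- consecutive edges of a path in G[D] through an internal vertex of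
  -- degree 2 in G[D]
  Link : Subset m → Fin m → Fin m → Set
  Link D e f = e ∈ D × f ∈ D
             × Σ (Fin n) λ v → 1 ≤ endsAt e v × 1 ≤ endsAt f v × deg D v ≡ 2

  SameSubdivisionClass : Subset m → Fin m → Fin m → Set
  SameSubdivisionClass D = Star (Link D)

  numBranch : Subset m → ℕ
  numBranch D = length (filter (λ v → 3 ≤? deg D v) (allFin n))

{-# OPTIONS --safe #-}
-- Adding to an independent set I an edge e with an end v of degree 0 in G[I] keeps it
-- independent, since contracting e onto its other end maps walks of I ∪ {e} to walks
-- of I. If v were a leaf of G[D] with edge e, a basis of D - e together with e would
-- be an independent subset of D of size r(D) + 1; so G[D] is leafless, and the
-- handshake lemma gives 2|V| + b ≤ 2|D|, where b counts vertices of degree ≥ 3.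
-- Every independent set I has |I| ≤ |V(I)|: a component with more edges than
-- vertices contains a cycle and, after deleting an edge of that cycle, a second one.
-- Hence |D| = r(D) + 2 ≤ |V| + 2 and b ≤ 4. Finally, if consecutive edges e, f of a
-- subdivision path lay in different circuit classes, the circuit D ∖ Pᵢ containing e
-- but not f would have a leaf at their common vertex, which the first argument
-- rules out.
module Submission where

open import Defs
open import Level using (0ℓ)
open import Data.Nat using (ℕ; zero; suc; _+_; _≤_; _<_; _≤?_; z≤n; s≤s)
open import Data.Nat.Properties renaming (_≟_ to _≟ℕ_)
open import Data.Nat.Induction using (<-wellFounded)
open import Data.Nat.Solver using (module +-*-Solver)
import Data.Nat.ListAction as ListAction
open import Data.Bool using (true; false; if_then_else_)
open import Data.Empty using (⊥)
open import Data.Fin using (Fin; zero; suc; punchIn; punchOut)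
open import Data.Fin.Properties using (_≟_; any?; punchInᵢ≢i; punchIn-punchOut)
open import Data.Fin.Subset using (Subset; Nonempty; _∈_; _∉_; _⊆_; _-_; _─_; _∪_; _∩_; ∁; ⁅_⁆; ∣_∣)
open import Data.Fin.Subset.Properties
import Data.List as List
open import Data.Vec using ([]; _∷_; lookup; tabulate; here; there)
open import Data.Vec.Properties using ([]=⇒lookup; lookup⇒[]=; lookup∘tabulate)
open import Data.Product using (Σ-syntax; _×_; _,_; proj₁; proj₂; ∃-syntax)
open import Data.Sum using (_⊎_; inj₁; inj₂)
open import Effect.Monad using (RawMonad)
open import Function using (id; _∘_)
open import Induction.WellFounded using (module All)
open import Relation.Nullary using (Dec; yes; no; does; ¬_; contradiction; ¬¬-excluded-middle; decidable-stable)
open import Relation.Nullary.Decidable using (dec-true)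
open import Relation.Nullary.Negation using (¬¬-Monad)
open import Relation.Binary.PropositionalEquality
open import Relation.Binary.Construct.Closure.ReflexiveTransitive using (ε; _◅_; _◅◅_; reverse; gmap; kleisliStar)
import Relation.Binary.Construct.On as On
open import Algebra.Properties.CommutativeMonoid.Sum +-0-commutativeMonoid
  using (sum; sum-syntax; sum-cong-≗; sum-remove; ∑-distrib-+; ∑-comm; sum-replicate-zero)

∑-mono-≤ : ∀ {k} {f g : Fin k → ℕ} → (∀ i → f i ≤ g i) → ∑[ i < k ] f i ≤ ∑[ i < k ] g i
∑-mono-≤ {zero}  f≤g = z≤n
∑-mono-≤ {suc k} {f} {g} f≤g = +-mono-≤ (f≤g zero) (∑-mono-≤ {f = f ∘ suc} {g ∘ suc} (f≤g ∘ suc))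

∑-mono-< : ∀ {k} {f g : Fin k → ℕ} i → (∀ j → f j ≤ g j) → f i < g i →
           ∑[ j < k ] f j < ∑[ j < k ] g j
∑-mono-< {suc k} {f} {g} i f≤g fi<gi = begin-strict
  sum f                     ≡⟨ sum-remove f ⟩
  f i + sum (f ∘ punchIn i) <⟨ +-mono-<-≤ fi<gi (∑-mono-≤ (f≤g ∘ punchIn i)) ⟩
  g i + sum (g ∘ punchIn i) ≡⟨ sum-remove g ⟨
  sum g                     ∎
  where open ≤-Reasoning

∑-term≤ : ∀ {k} (f : Fin k → ℕ) i → f i ≤ ∑[ j < k ] f j
∑-term≤ {suc k} f i = begin
  f i                       ≤⟨ m≤m+n (f i) _ ⟩
  f i + sum (f ∘ punchIn i) ≡⟨ sum-remove {i = i} f ⟨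
  sum f                     ∎
  where open ≤-Reasoning

∑-two-terms≤ : ∀ {k} (f : Fin k → ℕ) {i j} → i ≢ j → f i + f j ≤ ∑[ l < k ] f l
∑-two-terms≤ {suc k} f {i} {j} i≢j = begin
  f i + f j                          ≡⟨ cong (λ l → f i + f l) (punchIn-punchOut i≢j) ⟨
  f i + f (punchIn i (punchOut i≢j)) ≤⟨ +-monoʳ-≤ (f i) (∑-term≤ (f ∘ punchIn i) (punchOut i≢j)) ⟩
  f i + sum (f ∘ punchIn i)          ≡⟨ sum-remove {i = i} f ⟨
  sum f                              ∎
  where open ≤-Reasoning

∑-update : ∀ {k} (f g : Fin k → ℕ) i → (∀ j → j ≢ i → f j ≡ g j) →
           ∑[ j < k ] f j + g i ≡ ∑[ j < k ] g j + f i
∑-update {suc k} f g i f≡g = begin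
  sum f + g i                     ≡⟨ cong (_+ g i) (sum-remove {i = i} f) ⟩
  f i + sum (f ∘ punchIn i) + g i ≡⟨ cong (λ r → f i + r + g i) rest ⟩
  f i + sum (g ∘ punchIn i) + g i ≡⟨ swap (f i) (sum (g ∘ punchIn i)) (g i) ⟩
  g i + sum (g ∘ punchIn i) + f i ≡⟨ cong (_+ f i) (sum-remove {i = i} g) ⟨
  sum g + f i                     ∎
  where
  open ≡-Reasoning
  rest : sum (f ∘ punchIn i) ≡ sum (g ∘ punchIn i)
  rest = sum-cong-≗ (λ j → f≡g (punchIn i j) (punchInᵢ≢i i j))
  swap : ∀ a r b → a + r + b ≡ b + r + a
  swap a r b = trans (+-assoc a r b) (trans (+-comm a (r + b)) (cong (_+ a) (+-comm r b)))

∑-zero : ∀ {k} {f : Fin k → ℕ} → (∀ i → f i ≡ 0) → ∑[ i < k ] f i ≡ 0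
∑-zero {k} f≡0 = trans (sum-cong-≗ f≡0) (sum-replicate-zero k)

∑-positive : ∀ {k} (f : Fin k → ℕ) → 1 ≤ ∑[ i < k ] f i → ∃[ i ] 1 ≤ f i
∑-positive {suc k} f 1≤∑ with 1 ≤? f zero
... | yes 1≤f0 = zero , 1≤f0
... | no 1≰f0 with ∑-positive (f ∘ suc) (subst (λ x → 1 ≤ x + sum (f ∘ suc)) f0≡0 1≤∑)
  where f0≡0 = n<1⇒n≡0 (≰⇒> 1≰f0)
...   | i , 1≤fi = suc i , 1≤fi

indicator : ∀ {a} {A : Set a} → Dec A → ℕ
indicator d = if does d then 1 else 0

indicator-yes : ∀ {a} {A : Set a} (d : Dec A) → A → indicator d ≡ 1
indicator-yes (yes _) _ = refl
indicator-yes (no ¬a) a = contradiction a ¬a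

indicator-no : ∀ {a} {A : Set a} (d : Dec A) → ¬ A → indicator d ≡ 0
indicator-no (yes a) ¬a = contradiction a ¬a
indicator-no (no _)  _  = refl

indicator-mono : ∀ {a b} {A : Set a} {B : Set b} (d : Dec A) (d′ : Dec B) → (A → B) →
                 indicator d ≤ indicator d′
indicator-mono (yes a) (yes _) _   = ≤-refl
indicator-mono (yes a) (no ¬b) A⇒B = contradiction (A⇒B a) ¬b
indicator-mono (no _)  _       _   = z≤n

∑-indicator-≟ : ∀ {k} (a : Fin k) → ∑[ i < k ] indicator (i ≟ a) ≡ 1
∑-indicator-≟ {k} a = begin
  sum δ                    ≡⟨ +-identityʳ (sum δ) ⟨
  sum δ + 0                ≡⟨ ∑-update δ (λ _ → 0) a (λ i → indicator-no (i ≟ a)) ⟩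
  sum {k} (λ _ → 0) + δ a ≡⟨ cong₂ _+_ (∑-zero {k} λ _ → refl) (indicator-yes (a ≟ a) refl) ⟩
  1                        ∎
  where
  open ≡-Reasoning
  δ : Fin k → ℕ
  δ i = indicator (i ≟ a)

sum-map-tabulate : ∀ {A : Set} {k} (f : Fin k → A) (h : A → ℕ) →
                   ListAction.sum (List.map h (List.tabulate f)) ≡ ∑[ i < k ] h (f i)
sum-map-tabulate {k = zero}  f h = refl
sum-map-tabulate {k = suc k} f h = cong (h (f zero) +_) (sum-map-tabulate (f ∘ suc) h)

length-filter-tabulate : ∀ {A : Set} {p} {P : A → Set p} (P? : ∀ a → Dec (P a)) {k} (f : Fin k → A) →
                         List.length (List.filter P? (List.tabulate f)) ≡ ∑[ i < k ] indicator (P? (f i))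
length-filter-tabulate P? {zero}  f = refl
length-filter-tabulate P? {suc k} f with does (P? (f zero))
... | true  = cong suc (length-filter-tabulate P? (f ∘ suc))
... | false = length-filter-tabulate P? (f ∘ suc)

-- Reachability in G[J] is not decidable a priori, so the search for cycles runs in
-- the double-negation monad; all goals it is used for are decidable.

open RawMonad (¬¬-Monad {a = 0ℓ}) using (_>>=_; pure)

¬¬-∀-Fin : ∀ {k} {P : Fin k → Set} → (∀ i → ¬ ¬ P i) → ¬ ¬ (∀ i → P i)
¬¬-∀-Fin {zero}  _   = pure λ ()
¬¬-∀-Fin {suc k} ¬¬P = do
  p₀ ← ¬¬P zero
  ps ← ¬¬-∀-Fin (¬¬P ∘ suc)
  pure λ { zero → p₀ ; (suc i) → ps i }

¬¬-→ : ∀ {A B : Set} → (A → ¬ ¬ B) → ¬ ¬ (A → B)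
¬¬-→ ¬¬B ¬[A→B] = ¬[A→B] λ a → contradiction (λ b → ¬[A→B] λ _ → b) (¬¬B a)

weight : ∀ {m} → Subset m → (Fin m → ℕ) → Fin m → ℕ
weight J c e = if lookup J e then c e else 0

∑∈ : ∀ {m} → Subset m → (Fin m → ℕ) → ℕ
∑∈ {m} J c = ∑[ e < m ] weight J c e

syntax ∑∈ J (λ e → x) = ∑[ e ∈ J ] x

weight-∈ : ∀ {m} {J : Subset m} {e} c → e ∈ J → weight J c e ≡ c e
weight-∈ c e∈J rewrite []=⇒lookup e∈J = refl

weight-∉ : ∀ {m} {J : Subset m} {e} c → e ∉ J → weight J c e ≡ 0
weight-∉ {J = J} {e} c e∉J with lookup J e in eq
... | true  = contradiction (lookup⇒[]= e J eq) e∉J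
... | false = refl

weight-cong : ∀ {m} {J K : Subset m} {e} c → (e ∈ J → e ∈ K) → (e ∈ K → e ∈ J) →
              weight J c e ≡ weight K c e
weight-cong {J = J} {K} {e} c J⇒K K⇒J with e ∈? J
... | yes e∈J = trans (weight-∈ c e∈J) (sym (weight-∈ c (J⇒K e∈J)))
... | no  e∉J = trans (weight-∉ c e∉J) (sym (weight-∉ c (e∉J ∘ K⇒J)))

∣p∣≡∑[e∈p]1 : ∀ {m} (J : Subset m) → ∣ J ∣ ≡ ∑[ e ∈ J ] 1
∣p∣≡∑[e∈p]1 []          = refl
∣p∣≡∑[e∈p]1 (true ∷ J)  = cong suc (∣p∣≡∑[e∈p]1 J)
∣p∣≡∑[e∈p]1 (false ∷ J) = ∣p∣≡∑[e∈p]1 J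

x∈p─q⇒x∉q : ∀ {m} {x : Fin m} (p q : Subset m) → x ∈ p ─ q → x ∉ q
x∈p─q⇒x∉q (_ ∷ p) (false ∷ q) here          ()
x∈p─q⇒x∉q (_ ∷ p) (_     ∷ q) (there x∈p─q) (there x∈q) = x∈p─q⇒x∉q p q x∈p─q x∈q

x∉p-x : ∀ {m} (p : Subset m) x → x ∉ p - x
x∉p-x p x x∈p-x = x∈p─q⇒x∉q p ⁅ x ⁆ x∈p-x (x∈⁅x⁆ x)

∑∈-mono-⊆ : ∀ {m} {J K : Subset m} c → J ⊆ K → ∑∈ J c ≤ ∑∈ K c
∑∈-mono-⊆ {J = J} {K} c J⊆K = ∑-mono-≤ pointwise
  where
  pointwise : ∀ e → weight J c e ≤ weight K c e
  pointwise e with e ∈? J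
  ... | yes e∈J = ≤-reflexive (trans (weight-∈ c e∈J) (sym (weight-∈ c (J⊆K e∈J))))
  ... | no  e∉J = subst (_≤ weight K c e) (sym (weight-∉ c e∉J)) z≤n

∑∈-term≤ : ∀ {m} {J : Subset m} {g} c → g ∈ J → c g ≤ ∑∈ J c
∑∈-term≤ {J = J} {g} c g∈J = subst (_≤ ∑∈ J c) (weight-∈ c g∈J) (∑-term≤ (weight J c) g)

∑∈-two-terms≤ : ∀ {m} {J : Subset m} {g h} c → g ∈ J → h ∈ J → g ≢ h → c g + c h ≤ ∑∈ J c
∑∈-two-terms≤ {J = J} c g∈J h∈J g≢h =
  subst (_≤ ∑∈ J c) (cong₂ _+_ (weight-∈ c g∈J) (weight-∈ c h∈J)) (∑-two-terms≤ (weight J c) g≢h)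

∑∈-positive : ∀ {m} {J : Subset m} c → 1 ≤ ∑∈ J c → ∃[ e ] e ∈ J × 1 ≤ c e
∑∈-positive {J = J} c 1≤∑ with ∑-positive (weight J c) 1≤∑
... | e , 1≤w with e ∈? J
...   | yes e∈J = e , e∈J , subst (1 ≤_) (weight-∈ c e∈J) 1≤w
...   | no  e∉J = contradiction (subst (1 ≤_) (weight-∉ c e∉J) 1≤w) λ ()

∑∈-zero : ∀ {m} {J : Subset m} c → (∀ e → e ∈ J → c e ≡ 0) → ∑∈ J c ≡ 0
∑∈-zero {J = J} c c≡0 = ∑-zero pointwise
  where
  pointwise : ∀ e → weight J c e ≡ 0
  pointwise e with e ∈? J
  ... | yes e∈J = trans (weight-∈ c e∈J) (c≡0 e e∈J)
  ... | no  e∉J = weight-∉ c e∉J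

∑∈-remove : ∀ {m} {J : Subset m} {g} c → g ∈ J → ∑∈ (J - g) c + c g ≡ ∑∈ J c
∑∈-remove {J = J} {g} c g∈J = begin
  ∑∈ (J - g) c + c g          ≡⟨ cong (∑∈ (J - g) c +_) (weight-∈ c g∈J) ⟨
  ∑∈ (J - g) c + weight J c g ≡⟨ ∑-update (weight (J - g) c) (weight J c) g agree ⟩
  ∑∈ J c + weight (J - g) c g ≡⟨ cong (∑∈ J c +_) (weight-∉ c (x∉p-x J g)) ⟩
  ∑∈ J c + 0                  ≡⟨ +-identityʳ _ ⟩
  ∑∈ J c                      ∎
  where
  open ≡-Reasoning
  agree : ∀ e → e ≢ g → weight (J - g) c e ≡ weight J c e
  agree e e≢g = weight-cong {J = J - g} {J} c (p─q⊆p J ⁅ g ⁆) (λ e∈J → x∈p∧x≢y⇒x∈p-y e∈J e≢g)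

∑∈-insert : ∀ {m} {I : Subset m} {e} c → e ∉ I → ∑∈ (I ∪ ⁅ e ⁆) c ≡ ∑∈ I c + c e
∑∈-insert {I = I} {e} c e∉I = begin
  ∑∈ (I ∪ ⁅ e ⁆) c                ≡⟨ +-identityʳ _ ⟨
  ∑∈ (I ∪ ⁅ e ⁆) c + 0            ≡⟨ cong (∑∈ (I ∪ ⁅ e ⁆) c +_) (weight-∉ c e∉I) ⟨
  ∑∈ (I ∪ ⁅ e ⁆) c + weight I c e ≡⟨ ∑-update (weight (I ∪ ⁅ e ⁆) c) (weight I c) e agree ⟩
  ∑∈ I c + weight (I ∪ ⁅ e ⁆) c e ≡⟨ cong (∑∈ I c +_) (weight-∈ c e∈I∪⁅e⁆) ⟩
  ∑∈ I c + c e                    ∎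
  where
  open ≡-Reasoning
  e∈I∪⁅e⁆ : e ∈ I ∪ ⁅ e ⁆
  e∈I∪⁅e⁆ = x∈p∪q⁺ {p = I} (inj₂ (x∈⁅x⁆ e))
  agree : ∀ g → g ≢ e → weight (I ∪ ⁅ e ⁆) c g ≡ weight I c g
  agree g g≢e = weight-cong {J = I ∪ ⁅ e ⁆} {I} c drop (p⊆p∪q ⁅ e ⁆)
    where
    drop : g ∈ I ∪ ⁅ e ⁆ → g ∈ I
    drop g∈I∪e with x∈p∪q⁻ I ⁅ e ⁆ g∈I∪e
    ... | inj₁ g∈I = g∈I
    ... | inj₂ g∈e = contradiction (x∈⁅y⁆⇒x≡y e g∈e) g≢e

∑∈-split : ∀ {m} (J X : Subset m) c → ∑∈ J c ≡ ∑∈ (J ∩ X) c + ∑∈ (J ∩ ∁ X) c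
∑∈-split J X c = trans (sum-cong-≗ pointwise) (∑-distrib-+ (weight (J ∩ X) c) (weight (J ∩ ∁ X) c))
  where
  open ≡-Reasoning
  pointwise : ∀ e → weight J c e ≡ weight (J ∩ X) c e + weight (J ∩ ∁ X) c e
  pointwise e with e ∈? J | e ∈? X
  ... | yes e∈J | yes e∈X = begin
    weight J c e                              ≡⟨ weight-∈ c e∈J ⟩
    c e                                       ≡⟨ +-identityʳ (c e) ⟨
    c e + 0                                   ≡⟨ cong₂ _+_ (weight-∈ c e∈J∩X) (weight-∉ c e∉J∩∁X) ⟨
    weight (J ∩ X) c e + weight (J ∩ ∁ X) c e ∎
    where
    e∈J∩X = x∈p∩q⁺ (e∈J , e∈X)
    e∉J∩∁X = λ e∈J∩∁X → x∈∁p⇒x∉p (proj₂ (x∈p∩q⁻ J (∁ X) e∈J∩∁X)) e∈X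
  ... | yes e∈J | no e∉X = begin
    weight J c e                              ≡⟨ weight-∈ c e∈J ⟩
    c e                                       ≡⟨ cong₂ _+_ (weight-∉ c e∉J∩X) (weight-∈ c e∈J∩∁X) ⟨
    weight (J ∩ X) c e + weight (J ∩ ∁ X) c e ∎
    where
    e∉J∩X = λ e∈J∩X → e∉X (proj₂ (x∈p∩q⁻ J X e∈J∩X))
    e∈J∩∁X = x∈p∩q⁺ (e∈J , x∉p⇒x∈∁p e∉X)
  ... | no e∉J | _ = begin
    weight J c e                              ≡⟨ weight-∉ c e∉J ⟩
    0 + 0                                     ≡⟨ cong₂ _+_ (weight-∉ c (e∉J ∘ p∩q⊆p J X))
                                                           (weight-∉ c (e∉J ∘ p∩q⊆p J (∁ X))) ⟨
    weight (J ∩ X) c e + weight (J ∩ ∁ X) c e ∎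

∣p-x∣+1≡∣p∣ : ∀ {m} {p : Subset m} {x} → x ∈ p → ∣ p - x ∣ + 1 ≡ ∣ p ∣
∣p-x∣+1≡∣p∣ {p = p} {x} x∈p = begin
  ∣ p - x ∣ + 1        ≡⟨ cong (_+ 1) (∣p∣≡∑[e∈p]1 (p - x)) ⟩
  ∑[ e ∈ p - x ] 1 + 1 ≡⟨ ∑∈-remove (λ _ → 1) x∈p ⟩
  ∑[ e ∈ p ] 1         ≡⟨ ∣p∣≡∑[e∈p]1 p ⟨
  ∣ p ∣                ∎
  where open ≡-Reasoning

∣p∪⁅x⁆∣≡∣p∣+1 : ∀ {m} {p : Subset m} {x} → x ∉ p → ∣ p ∪ ⁅ x ⁆ ∣ ≡ ∣ p ∣ + 1
∣p∪⁅x⁆∣≡∣p∣+1 {p = p} {x} x∉p = begin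
  ∣ p ∪ ⁅ x ⁆ ∣          ≡⟨ ∣p∣≡∑[e∈p]1 (p ∪ ⁅ x ⁆) ⟩
  ∑[ e ∈ p ∪ ⁅ x ⁆ ] 1  ≡⟨ ∑∈-insert (λ _ → 1) x∉p ⟩
  ∑[ e ∈ p ] 1 + 1      ≡⟨ cong (_+ 1) (∣p∣≡∑[e∈p]1 p) ⟨
  ∣ p ∣ + 1             ∎
  where open ≡-Reasoning

p∪⁅x⁆⊆q : ∀ {m} {p q : Subset m} {x} → p ⊆ q → x ∈ q → p ∪ ⁅ x ⁆ ⊆ q
p∪⁅x⁆⊆q {p = p} {x = x} p⊆q x∈q y∈ with x∈p∪q⁻ p ⁅ x ⁆ y∈
... | inj₁ y∈p = p⊆q y∈p
... | inj₂ y∈⁅x⁆ rewrite x∈⁅y⁆⇒x≡y x y∈⁅x⁆ = x∈q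

p⊆p-x∪⁅x⁆ : ∀ {m} (p : Subset m) x → p ⊆ (p - x) ∪ ⁅ x ⁆
p⊆p-x∪⁅x⁆ p x {y} y∈p with y ≟ x
... | yes refl = x∈p∪q⁺ {p = p - x} (inj₂ (x∈⁅x⁆ x))
... | no y≢x   = x∈p∪q⁺ (inj₁ (x∈p∧x≢y⇒x∈p-y y∈p y≢x))

card-rec : ∀ {m ℓ} (P : Subset m → Set ℓ) →
           (∀ J → (∀ {K} → ∣ K ∣ < ∣ J ∣ → P K) → P J) → ∀ J → P J
card-rec {ℓ = ℓ} = All.wfRec (On.wellFounded ∣_∣ <-wellFounded) ℓ

∣p∣-positive : ∀ {m} {p : Subset m} → 1 ≤ ∣ p ∣ → Nonempty p
∣p∣-positive {p = p} 1≤∣p∣ with ∑∈-positive (λ _ → 1) (subst (1 ≤_) (∣p∣≡∑[e∈p]1 p) 1≤∣p∣)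
... | e , e∈p , _ = e , e∈p

module _ {n m : ℕ} (G : Graph n m) where
  open Graph G

  end₁ end₂ : Fin m → Fin n
  end₁ = proj₁ ∘ ends
  end₂ = proj₂ ∘ ends

  endsAt-end₁ : ∀ e → 1 ≤ endsAt G e (end₁ e)
  endsAt-end₁ e rewrite indicator-yes (end₁ e ≟ end₁ e) refl = s≤s z≤n

  endsAt-end₂ : ∀ e → 1 ≤ endsAt G e (end₂ e)
  endsAt-end₂ e rewrite indicator-yes (end₂ e ≟ end₂ e) refl = m≤n+m 1 _

  ∑-endsAt : ∀ e → ∑[ v < n ] endsAt G e v ≡ 2
  ∑-endsAt e = trans (∑-distrib-+ (λ v → indicator (v ≟ end₁ e)) (λ v → indicator (v ≟ end₂ e)))
                     (cong₂ _+_ (∑-indicator-≟ (end₁ e)) (∑-indicator-≟ (end₂ e)))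

  endsAt-positive : ∀ e v → 1 ≤ endsAt G e v → v ≡ end₁ e ⊎ v ≡ end₂ e
  endsAt-positive e v 1≤ with v ≟ end₁ e | v ≟ end₂ e
  ... | yes v≡end₁ | _          = inj₁ v≡end₁
  ... | no _       | yes v≡end₂ = inj₂ v≡end₂
  ... | no _       | no _       = contradiction 1≤ λ ()

  endsAt≡1⇒otherEnd : ∀ e v → endsAt G e v ≡ 1 → ∃[ x ] x ≢ v × (ends e ≡ (v , x) ⊎ ends e ≡ (x , v))
  endsAt≡1⇒otherEnd e v ≡1 with v ≟ end₁ e | v ≟ end₂ e
  ... | yes refl | no v≢end₂ = end₂ e , v≢end₂ ∘ sym , inj₁ refl
  ... | no v≢end₁ | yes refl = end₁ e , v≢end₁ ∘ sym , inj₂ refl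
  ... | yes _ | yes _ with ≡1
  ...   | ()
  endsAt≡1⇒otherEnd e v () | no _ | no _

  ends⇒endsAt : ∀ {e a b} → ends e ≡ (a , b) ⊎ ends e ≡ (b , a) → 1 ≤ endsAt G e a × 1 ≤ endsAt G e b
  ends⇒endsAt {e} (inj₁ refl) = endsAt-end₁ e , endsAt-end₂ e
  ends⇒endsAt {e} (inj₂ refl) = endsAt-end₂ e , endsAt-end₁ e

  deg≡∑∈ : ∀ J v → deg G J v ≡ ∑[ e ∈ J ] endsAt G e v
  deg≡∑∈ J v = sum-map-tabulate id (λ e → if lookup J e then endsAt G e v else 0)

  deg-mono-⊆ : ∀ {J K} → J ⊆ K → ∀ v → deg G J v ≤ deg G K v
  deg-mono-⊆ {J} {K} J⊆K v rewrite deg≡∑∈ J v | deg≡∑∈ K v = ∑∈-mono-⊆ (λ e → endsAt G e v) J⊆K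

  endsAt≤deg : ∀ {J e} → e ∈ J → ∀ v → endsAt G e v ≤ deg G J v
  endsAt≤deg {J} e∈J v rewrite deg≡∑∈ J v = ∑∈-term≤ (λ e → endsAt G e v) e∈J

  endsAt+endsAt≤deg : ∀ {J e f} → e ∈ J → f ∈ J → e ≢ f → ∀ v →
                      endsAt G e v + endsAt G f v ≤ deg G J v
  endsAt+endsAt≤deg {J} e∈J f∈J e≢f v rewrite deg≡∑∈ J v =
    ∑∈-two-terms≤ (λ e → endsAt G e v) e∈J f∈J e≢f

  deg-positive : ∀ {J v} → 1 ≤ deg G J v → ∃[ e ] e ∈ J × 1 ≤ endsAt G e v
  deg-positive {J} {v} 1≤deg = ∑∈-positive (λ e → endsAt G e v) (subst (1 ≤_) (deg≡∑∈ J v) 1≤deg)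

  deg-remove : ∀ {J g} → g ∈ J → ∀ v → deg G (J - g) v + endsAt G g v ≡ deg G J v
  deg-remove {J} {g} g∈J v rewrite deg≡∑∈ (J - g) v | deg≡∑∈ J v =
    ∑∈-remove (λ e → endsAt G e v) g∈J

  deg-insert : ∀ {I e} → e ∉ I → ∀ v → deg G (I ∪ ⁅ e ⁆) v ≡ deg G I v + endsAt G e v
  deg-insert {I} {e} e∉I v rewrite deg≡∑∈ (I ∪ ⁅ e ⁆) v | deg≡∑∈ I v =
    ∑∈-insert (λ e → endsAt G e v) e∉I

  isVertex-end₁ : ∀ {J e} → e ∈ J → IsVertex G J (end₁ e)
  isVertex-end₁ {e = e} e∈J = ≤-trans (endsAt-end₁ e) (endsAt≤deg e∈J (end₁ e))

  handshake : ∀ J → ∑[ v < n ] deg G J v ≡ ∣ J ∣ + ∣ J ∣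
  handshake J = begin
    ∑[ v < n ] deg G J v                   ≡⟨ sum-cong-≗ (deg≡∑∈ J) ⟩
    ∑[ v < n ] ∑[ e < m ] w v e             ≡⟨ ∑-comm w ⟩
    ∑[ e < m ] ∑[ v < n ] w v e             ≡⟨ sum-cong-≗ twice ⟩
    ∑[ e < m ] (weight J 1s e + weight J 1s e) ≡⟨ ∑-distrib-+ (weight J 1s) (weight J 1s) ⟩
    ∑[ e ∈ J ] 1 + ∑[ e ∈ J ] 1            ≡⟨ cong₂ _+_ (∣p∣≡∑[e∈p]1 J) (∣p∣≡∑[e∈p]1 J) ⟨
    ∣ J ∣ + ∣ J ∣                           ∎
    where
    open ≡-Reasoning
    w : Fin n → Fin m → ℕ
    w v = weight J (λ e → endsAt G e v)
    1s : Fin m → ℕ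
    1s _ = 1
    twice : ∀ e → ∑[ v < n ] w v e ≡ weight J 1s e + weight J 1s e
    twice e with lookup J e
    ... | true  = ∑-endsAt e
    ... | false = ∑-zero {n} λ _ → refl

  Adj-sym : ∀ {J u v} → Adj G J u v → Adj G J v u
  Adj-sym (e , e∈J , inj₁ uv) = e , e∈J , inj₂ uv
  Adj-sym (e , e∈J , inj₂ vu) = e , e∈J , inj₁ vu

  Reach-sym : ∀ {J u v} → Reach G J u v → Reach G J v u
  Reach-sym = reverse Adj-sym

  Reach-mono-⊆ : ∀ {J K} → J ⊆ K → ∀ {u v} → Reach G J u v → Reach G K u v
  Reach-mono-⊆ J⊆K = gmap id λ (e , e∈J , uv) → e , J⊆K e∈J , uv

  Reach-along-edge : ∀ {J e} → e ∈ J → ∀ v → 1 ≤ endsAt G e v → Reach G J (end₁ e) v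
  Reach-along-edge {e = e} e∈J v 1≤ with endsAt-positive e v 1≤
  ... | inj₁ refl = ε
  ... | inj₂ refl = (e , e∈J , inj₁ refl) ◅ ε

  Independent-antitone : ∀ {J I} → J ⊆ I → Independent G I → Independent G J
  Independent-antitone J⊆I indep C₁ C₂ C₁⊆J C₂⊆J cyc₁ cyc₂ C₁≢C₂ u v u∈C₁ v∈C₂ =
    indep C₁ C₂ (⊆-trans C₁⊆J J⊆I) (⊆-trans C₂⊆J J⊆I) cyc₁ cyc₂ C₁≢C₂ u v u∈C₁ v∈C₂
      ∘ Reach-mono-⊆ J⊆I

  -- Pendant edges

  Leafless : Subset m → Set
  Leafless J = ∀ v → deg G J v ≢ 1

  leaf-edge : ∀ J v → deg G J v ≡ 1 → ∃[ e ] e ∈ J × endsAt G e v ≡ 1 × deg G (J - e) v ≡ 0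
  leaf-edge J v deg≡1 with deg-positive {J} {v} (≤-reflexive (sym deg≡1))
  ... | e , e∈J , 1≤eᵥ = e , e∈J , eᵥ≡1 , +-cancelʳ-≡ 1 _ 0 (begin
      deg G (J - e) v + 1            ≡⟨ cong (deg G (J - e) v +_) eᵥ≡1 ⟨
      deg G (J - e) v + endsAt G e v ≡⟨ deg-remove e∈J v ⟩
      deg G J v                      ≡⟨ deg≡1 ⟩
      1                              ∎)
    where
    open ≡-Reasoning
    eᵥ≡1 : endsAt G e v ≡ 1
    eᵥ≡1 = ≤-antisym (subst (endsAt G e v ≤_) deg≡1 (endsAt≤deg e∈J v)) 1≤eᵥ

  module Pendant {I e v} (e∉I : e ∉ I) (eᵥ≡1 : endsAt G e v ≡ 1) (degIv≡0 : deg G I v ≡ 0) where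

    deg-∪-v≡1 : deg G (I ∪ ⁅ e ⁆) v ≡ 1
    deg-∪-v≡1 = trans (deg-insert e∉I v) (cong₂ _+_ degIv≡0 eᵥ≡1)

    v-not-in-I : ∀ {y} → IsVertex G I y → y ≢ v
    v-not-in-I {y} 1≤deg refl = contradiction (subst (1 ≤_) degIv≡0 1≤deg) λ ()

    cycle-⊆ : ∀ {C} → C ⊆ I ∪ ⁅ e ⁆ → Cycle G C → C ⊆ I
    cycle-⊆ {C} C⊆ (_ , regular , _) {g} g∈C with x∈p∪q⁻ I ⁅ e ⁆ (C⊆ g∈C)
    ... | inj₁ g∈I = g∈I
    ... | inj₂ g∈⁅e⁆ rewrite x∈⁅y⁆⇒x≡y e g∈⁅e⁆ = contradiction (begin
        2                      ≡⟨ regular v 1≤degCv ⟨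
        deg G C v              ≤⟨ deg-mono-⊆ C⊆ v ⟩
        deg G (I ∪ ⁅ e ⁆) v    ≡⟨ deg-∪-v≡1 ⟩
        1                      ∎) λ { (s≤s ()) }
      where
      open ≤-Reasoning
      1≤degCv : IsVertex G C v
      1≤degCv = ≤-trans (≤-reflexive (sym eᵥ≡1)) (endsAt≤deg g∈C v)

    private
      x : Fin n
      x = proj₁ (endsAt≡1⇒otherEnd e v eᵥ≡1)

      x≢v : x ≢ v
      x≢v = proj₁ (proj₂ (endsAt≡1⇒otherEnd e v eᵥ≡1))

      end-of-e : ∀ {y} → 1 ≤ endsAt G e y → y ≡ v ⊎ y ≡ x
      end-of-e {y} 1≤ with endsAt-positive e y 1≤ | proj₂ (proj₂ (endsAt≡1⇒otherEnd e v eᵥ≡1))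
      ... | inj₁ refl | inj₁ vx = inj₁ (cong proj₁ vx)
      ... | inj₂ refl | inj₁ vx = inj₂ (cong proj₂ vx)
      ... | inj₁ refl | inj₂ xv = inj₂ (cong proj₁ xv)
      ... | inj₂ refl | inj₂ xv = inj₁ (cong proj₂ xv)

      contract : Fin n → Fin n
      contract y = if does (y ≟ v) then x else y

      contract-≢ : ∀ {y} → y ≢ v → contract y ≡ y
      contract-≢ {y} y≢v with y ≟ v
      ... | yes y≡v = contradiction y≡v y≢v
      ... | no _    = refl

      contract-v : contract v ≡ x
      contract-v with v ≟ v
      ... | yes _   = refl
      ... | no v≢v = contradiction refl v≢v

      contract-end : ∀ {y} → 1 ≤ endsAt G e y → contract y ≡ x
      contract-end {y} 1≤ with end-of-e {y} 1≤
      ... | inj₁ refl = contract-v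
      ... | inj₂ refl = contract-≢ x≢v

      contract-step : ∀ {a b} → Adj G (I ∪ ⁅ e ⁆) a b → Reach G I (contract a) (contract b)
      contract-step {a} {b} (g , g∈ , ab) with x∈p∪q⁻ I ⁅ e ⁆ g∈ | ends⇒endsAt ab
      ... | inj₁ g∈I | 1≤gₐ , 1≤g_b =
        subst₂ (Reach G I) (sym (contract-≢ (v-not-in-I (≤-trans 1≤gₐ (endsAt≤deg g∈I a)))))
                           (sym (contract-≢ (v-not-in-I (≤-trans 1≤g_b (endsAt≤deg g∈I b)))))
                           ((g , g∈I , ab) ◅ ε)
      ... | inj₂ g∈⁅e⁆ | 1≤gₐ , 1≤g_b =
        subst₂ (Reach G I) (sym (via-e {a} 1≤gₐ)) (sym (via-e {b} 1≤g_b)) ε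
        where
        via-e : ∀ {y} → 1 ≤ endsAt G g y → contract y ≡ x
        via-e {y} rewrite x∈⁅y⁆⇒x≡y e g∈⁅e⁆ = contract-end {y}

    Reach-shortcut : ∀ {a b} → IsVertex G I a → IsVertex G I b → Reach G (I ∪ ⁅ e ⁆) a b → Reach G I a b
    Reach-shortcut a∈I b∈I r =
      subst₂ (Reach G I) (contract-≢ (v-not-in-I a∈I)) (contract-≢ (v-not-in-I b∈I))
             (kleisliStar contract contract-step r)

  Independent-∪-pendant : ∀ {I e v} → Independent G I → e ∉ I → endsAt G e v ≡ 1 → deg G I v ≡ 0 →
                          Independent G (I ∪ ⁅ e ⁆)
  Independent-∪-pendant {I} {e} {v} indep e∉I eᵥ≡1 degIv≡0
                        C₁ C₂ C₁⊆ C₂⊆ cyc₁ cyc₂ C₁≢C₂ u u′ u∈C₁ u′∈C₂ =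
    indep C₁ C₂ C₁⊆I C₂⊆I cyc₁ cyc₂ C₁≢C₂ u u′ u∈C₁ u′∈C₂
      ∘ Reach-shortcut (≤-trans u∈C₁ (deg-mono-⊆ C₁⊆I u)) (≤-trans u′∈C₂ (deg-mono-⊆ C₂⊆I u′))
    where
    open Pendant {I} {e} {v} e∉I eᵥ≡1 degIv≡0
    C₁⊆I = cycle-⊆ C₁⊆ cyc₁
    C₂⊆I = cycle-⊆ C₂⊆ cyc₂

  -- #deg≥ 1 J is the number of vertices of G[J].
  #deg≥ : ℕ → Subset m → ℕ
  #deg≥ t J = ∑[ v < n ] indicator (t ≤? deg G J v)

  numBranch≡#deg≥3 : ∀ J → numBranch G J ≡ #deg≥ 3 J
  numBranch≡#deg≥3 J = length-filter-tabulate (λ v → 3 ≤? deg G J v) id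

  #deg≥-mono-⊆ : ∀ t {J K} → J ⊆ K → #deg≥ t J ≤ #deg≥ t K
  #deg≥-mono-⊆ t J⊆K =
    ∑-mono-≤ λ v → indicator-mono (t ≤? _) (t ≤? _) λ t≤ → ≤-trans t≤ (deg-mono-⊆ J⊆K v)

  #deg≥-positive : ∀ t J v → t ≤ deg G J v → 1 ≤ #deg≥ t J
  #deg≥-positive t J v t≤ = ≤-trans (≤-reflexive (sym (indicator-yes (t ≤? deg G J v) t≤))) (∑-term≤ _ v)

  #deg≥1-two : ∀ J x y → x ≢ y → IsVertex G J x → IsVertex G J y → 2 ≤ #deg≥ 1 J
  #deg≥1-two J x y x≢y x∈J y∈J =
    subst (_≤ #deg≥ 1 J) (cong₂ _+_ (indicator-yes (1 ≤? deg G J x) x∈J) (indicator-yes (1 ≤? deg G J y) y∈J))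
          (∑-two-terms≤ (λ v → indicator (1 ≤? deg G J v)) x≢y)

  #deg≥1-remove-leaf : ∀ J {e} v → e ∈ J → IsVertex G J v → deg G (J - e) v ≡ 0 →
                       #deg≥ 1 (J - e) < #deg≥ 1 J
  #deg≥1-remove-leaf J {e} v e∈J v∈J degJ-e-v≡0 = ∑-mono-< v
    (λ w → indicator-mono (1 ≤? _) (1 ≤? _) λ 1≤ → ≤-trans 1≤ (deg-mono-⊆ (p─q⊆p J ⁅ e ⁆) w))
    (subst₂ _<_ (sym (indicator-no (1 ≤? deg G (J - e) v) v∉J-e))
                (sym (indicator-yes (1 ≤? deg G J v) v∈J)) (s≤s z≤n))
    where
    v∉J-e : ¬ IsVertex G (J - e) v
    v∉J-e 1≤ = contradiction (subst (1 ≤_) degJ-e-v≡0 1≤) λ ()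

  handshake-leafless : ∀ J → Leafless J → #deg≥ 1 J + #deg≥ 1 J + #deg≥ 3 J ≤ ∣ J ∣ + ∣ J ∣
  handshake-leafless J leafless = begin
    #deg≥ 1 J + #deg≥ 1 J + #deg≥ 3 J        ≡⟨ cong (_+ #deg≥ 3 J) (∑-distrib-+ ind₁ ind₁) ⟨
    ∑[ v < n ] (ind₁ v + ind₁ v) + #deg≥ 3 J ≡⟨ ∑-distrib-+ (λ v → ind₁ v + ind₁ v) ind₃ ⟨
    ∑[ v < n ] (ind₁ v + ind₁ v + ind₃ v)    ≤⟨ ∑-mono-≤ (λ v → per-vertex (deg G J v) (leafless v)) ⟩
    ∑[ v < n ] deg G J v                     ≡⟨ handshake J ⟩
    ∣ J ∣ + ∣ J ∣                             ∎
    where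
    open ≤-Reasoning
    ind₁ ind₃ : Fin n → ℕ
    ind₁ v = indicator (1 ≤? deg G J v)
    ind₃ v = indicator (3 ≤? deg G J v)
    per-vertex : ∀ d → d ≢ 1 → indicator (1 ≤? d) + indicator (1 ≤? d) + indicator (3 ≤? d) ≤ d
    per-vertex zero                _   = z≤n
    per-vertex (suc zero)          d≢1 = contradiction refl d≢1
    per-vertex (suc (suc zero))    _   = ≤-refl
    per-vertex (suc (suc (suc d))) _   = s≤s (s≤s (s≤s z≤n))

  -- Leaves and subdivision classes

  doubleCircuit-leafless : ∀ {D} → DoubleCircuit G D → Leafless D
  doubleCircuit-leafless {D} (k , (_ , rank≤k) , _ , rank-D-d≡k) v degDv≡1
    with leaf-edge D v degDv≡1
  ... | e , e∈D , eᵥ≡1 , degD-e-v≡0 with rank-D-d≡k e e∈D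
  ...   | (I , I⊆D-e , indep , ∣I∣≡k) , _ = <⇒≱ (n<1+n k) (begin
      suc k         ≡⟨ +-comm 1 k ⟩
      k + 1         ≡⟨ cong (_+ 1) ∣I∣≡k ⟨
      ∣ I ∣ + 1      ≡⟨ ∣p∪⁅x⁆∣≡∣p∣+1 e∉I ⟨
      ∣ I ∪ ⁅ e ⁆ ∣ ≤⟨ rank≤k (I ∪ ⁅ e ⁆) I∪⁅e⁆⊆D I∪⁅e⁆-independent ⟩
      k             ∎)
    where
    open ≤-Reasoning
    e∉I : e ∉ I
    e∉I = x∉p-x D e ∘ I⊆D-e
    I∪⁅e⁆⊆D : I ∪ ⁅ e ⁆ ⊆ D
    I∪⁅e⁆⊆D = p∪⁅x⁆⊆q (⊆-trans I⊆D-e (p─q⊆p D ⁅ e ⁆)) e∈D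
    degIv≡0 : deg G I v ≡ 0
    degIv≡0 = n≤0⇒n≡0 (subst (deg G I v ≤_) degD-e-v≡0 (deg-mono-⊆ I⊆D-e v))
    I∪⁅e⁆-independent : Independent G (I ∪ ⁅ e ⁆)
    I∪⁅e⁆-independent = Independent-∪-pendant {v = v} indep e∉I eᵥ≡1 degIv≡0

  private
    sum≤2⇒both≡1 : ∀ {a b} → a + b ≤ 2 → 1 ≤ a → 1 ≤ b → a ≡ 1 × b ≡ 1
    sum≤2⇒both≡1 {suc zero}    {suc zero}    _              _ _ = refl , refl
    sum≤2⇒both≡1 {suc zero}    {suc (suc _)} (s≤s (s≤s ())) _ _
    sum≤2⇒both≡1 {suc (suc _)} a+b≤2 _ 1≤b =
      contradiction (≤-trans (+-mono-≤ (s≤s (s≤s z≤n)) 1≤b) a+b≤2) λ { (s≤s (s≤s ())) }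

  module _ {D k} {P : Fin k → Subset m} (partition : IsCircuitPartition G D P) where

    private
      covers = proj₁ (proj₂ partition)
      circuit = proj₂ (proj₂ (proj₂ (proj₂ partition)))

    Link-preserves-class : ∀ {e g} i → Link G D e g → g ∈ P i → e ∈ P i
    Link-preserves-class {e} {g} i (e∈D , g∈D , v , 1≤eᵥ , 1≤gᵥ , degDv≡2) g∈Pi with e ∈? P i
    ... | yes e∈Pi = e∈Pi
    ... | no  e∉Pi = contradiction C-independent (proj₁ (circuit i))
      where
      C = D ─ P i
      e∈C : e ∈ C
      e∈C = x∈p∧x∉q⇒x∈p─q e∈D e∉Pi
      C⊆D-g : C ⊆ D - g
      C⊆D-g h∈C = x∈p∧x≢y⇒x∈p-y (p─q⊆p D (P i) h∈C) λ { refl → x∈p─q⇒x∉q D (P i) h∈C g∈Pi }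
      eᵥ+gᵥ≤2 : endsAt G e v + endsAt G g v ≤ 2
      eᵥ+gᵥ≤2 = subst (endsAt G e v + endsAt G g v ≤_) degDv≡2
                      (endsAt+endsAt≤deg e∈D g∈D (λ { refl → e∉Pi g∈Pi }) v)
      eᵥ≡1 : endsAt G e v ≡ 1
      eᵥ≡1 = proj₁ (sum≤2⇒both≡1 eᵥ+gᵥ≤2 1≤eᵥ 1≤gᵥ)
      gᵥ≡1 : endsAt G g v ≡ 1
      gᵥ≡1 = proj₂ (sum≤2⇒both≡1 eᵥ+gᵥ≤2 1≤eᵥ 1≤gᵥ)
      degC-e-v≡0 : deg G (C - e) v ≡ 0
      degC-e-v≡0 = n≤0⇒n≡0 (+-cancelʳ-≤ 2 _ 0 (begin
        deg G (C - e) v + 2                             ≡⟨ cong (deg G (C - e) v +_) (cong₂ _+_ eᵥ≡1 gᵥ≡1) ⟨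
        deg G (C - e) v + (endsAt G e v + endsAt G g v) ≡⟨ +-assoc (deg G (C - e) v) _ _ ⟨
        deg G (C - e) v + endsAt G e v + endsAt G g v   ≡⟨ cong (_+ endsAt G g v) (deg-remove e∈C v) ⟩
        deg G C v + endsAt G g v                        ≤⟨ +-monoˡ-≤ (endsAt G g v) (deg-mono-⊆ C⊆D-g v) ⟩
        deg G (D - g) v + endsAt G g v                  ≡⟨ deg-remove g∈D v ⟩
        deg G D v                                       ≡⟨ degDv≡2 ⟩
        2                                               ∎))
        where open ≤-Reasoning
      C-independent : Independent G C
      C-independent = Independent-antitone (p⊆p-x∪⁅x⁆ C e)
                        (Independent-∪-pendant {v = v} (proj₂ (circuit i) e e∈C) (x∉p-x C e) eᵥ≡1 degC-e-v≡0)

    sameSubdivisionClass⇒sameCircuitClass : ∀ {e f} → e ∈ D → SameSubdivisionClass G D e f →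
                                            ∃[ i ] e ∈ P i × f ∈ P i
    sameSubdivisionClass⇒sameCircuitClass e∈D ε = let i , e∈Pi = covers _ e∈D in i , e∈Pi , e∈Pi
    sameSubdivisionClass⇒sameCircuitClass _ (link ◅ links) =
      let i , g∈Pi , f∈Pi = sameSubdivisionClass⇒sameCircuitClass (proj₁ (proj₂ link)) links
      in i , Link-preserves-class i link g∈Pi , f∈Pi

  -- Independent sets have at most as many edges as vertices

  module Component (J : Subset m) (u : Fin n) (reach? : ∀ g → Dec (Reach G J u (end₁ g))) where

    Reached K R : Subset m
    Reached = tabulate (does ∘ reach?)
    K = J ∩ Reached
    R = J ∩ ∁ Reached

    ∈Reached⇒Reach : ∀ {g} → g ∈ Reached → Reach G J u (end₁ g)
    ∈Reached⇒Reach {g} g∈ with reach? g | trans (sym (lookup∘tabulate (does ∘ reach?) g)) ([]=⇒lookup g∈)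
    ... | yes r | _ = r
    ... | no _  | ()

    Reach⇒∈Reached : ∀ {g} → Reach G J u (end₁ g) → g ∈ Reached
    Reach⇒∈Reached {g} r = lookup⇒[]= g Reached (trans (lookup∘tabulate (does ∘ reach?) g) (dec-true (reach? g) r))

    K⊆J : K ⊆ J
    K⊆J = p∩q⊆p J Reached

    R⊆J : R ⊆ J
    R⊆J = p∩q⊆p J (∁ Reached)

    ∈K⇒Reach : ∀ {g} → g ∈ K → Reach G J u (end₁ g)
    ∈K⇒Reach g∈K = ∈Reached⇒Reach (proj₂ (x∈p∩q⁻ J Reached g∈K))

    Reach⇒∈K : ∀ {g} → g ∈ J → Reach G J u (end₁ g) → g ∈ K
    Reach⇒∈K g∈J r = x∈p∩q⁺ (g∈J , Reach⇒∈Reached r)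

    ∈R⇒¬Reach : ∀ {g} → g ∈ R → ¬ Reach G J u (end₁ g)
    ∈R⇒¬Reach g∈R r = x∈∁p⇒x∉p (proj₂ (x∈p∩q⁻ J (∁ Reached) g∈R)) (Reach⇒∈Reached r)

    ∣J∣≡∣K∣+∣R∣ : ∣ J ∣ ≡ ∣ K ∣ + ∣ R ∣
    ∣J∣≡∣K∣+∣R∣ = begin
      ∣ J ∣                       ≡⟨ ∣p∣≡∑[e∈p]1 J ⟩
      ∑[ e ∈ J ] 1                ≡⟨ ∑∈-split J Reached (λ _ → 1) ⟩
      ∑[ e ∈ K ] 1 + ∑[ e ∈ R ] 1 ≡⟨ cong₂ _+_ (∣p∣≡∑[e∈p]1 K) (∣p∣≡∑[e∈p]1 R) ⟨
      ∣ K ∣ + ∣ R ∣                ∎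
      where open ≡-Reasoning

    deg-split : ∀ x → deg G J x ≡ deg G K x + deg G R x
    deg-split x = begin
      deg G J x                                         ≡⟨ deg≡∑∈ J x ⟩
      ∑[ e ∈ J ] endsAt G e x                           ≡⟨ ∑∈-split J Reached (λ e → endsAt G e x) ⟩
      ∑[ e ∈ K ] endsAt G e x + ∑[ e ∈ R ] endsAt G e x ≡⟨ cong₂ _+_ (deg≡∑∈ K x) (deg≡∑∈ R x) ⟨
      deg G K x + deg G R x                             ∎
      where open ≡-Reasoning

    isVertex-K⇒Reach : ∀ {x} → IsVertex G K x → Reach G J u x
    isVertex-K⇒Reach {x} x∈K with deg-positive {K} {x} x∈K
    ... | g , g∈K , 1≤gₓ = ∈K⇒Reach g∈K ◅◅ Reach-along-edge (K⊆J g∈K) x 1≤gₓ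

    Reach⇒deg-R≡0 : ∀ {x} → Reach G J u x → deg G R x ≡ 0
    Reach⇒deg-R≡0 {x} r = trans (deg≡∑∈ R x) (∑∈-zero (λ e → endsAt G e x) no-edge)
      where
      no-edge : ∀ g → g ∈ R → endsAt G g x ≡ 0
      no-edge g g∈R with 1 ≤? endsAt G g x
      ... | yes 1≤gₓ = contradiction (r ◅◅ Reach-sym (Reach-along-edge (R⊆J g∈R) x 1≤gₓ))
                                     (∈R⇒¬Reach g∈R)
      ... | no  1≰gₓ = n<1⇒n≡0 (≰⇒> 1≰gₓ)

    Reach⇒deg-K≡deg-J : ∀ {x} → Reach G J u x → deg G K x ≡ deg G J x
    Reach⇒deg-K≡deg-J {x} r = begin
      deg G K x             ≡⟨ +-identityʳ _ ⟨
      deg G K x + 0         ≡⟨ cong (deg G K x +_) (Reach⇒deg-R≡0 r) ⟨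
      deg G K x + deg G R x ≡⟨ deg-split x ⟨
      deg G J x             ∎
      where open ≡-Reasoning

    K-leafless : Leafless J → Leafless K
    K-leafless leafless x degKx≡1 =
      leafless x (trans (sym (Reach⇒deg-K≡deg-J (isVertex-K⇒Reach {x} (≤-reflexive (sym degKx≡1))))) degKx≡1)

    K-nonempty : IsVertex G J u → Nonempty K
    K-nonempty u∈J with deg-positive {J} {u} u∈J
    ... | g , g∈J , 1≤gᵤ = g , Reach⇒∈K g∈J (Reach-sym (Reach-along-edge g∈J u 1≤gᵤ))

    K-smaller : ∀ {v} → IsVertex G J v → ¬ Reach G J u v → ∣ K ∣ < ∣ J ∣
    K-smaller {v} v∈J ¬r with deg-positive {J} {v} v∈J
    ... | h , h∈J , 1≤hᵥ = ≤-<-trans (p⊆q⇒∣p∣≤∣q∣ K⊆J-h) (x∈p⇒∣p-x∣<∣p∣ h∈J)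
      where
      K⊆J-h : K ⊆ J - h
      K⊆J-h g∈K = x∈p∧x≢y⇒x∈p-y (K⊆J g∈K)
                    λ { refl → ¬r (∈K⇒Reach g∈K ◅◅ Reach-along-edge h∈J v 1≤hᵥ) }

    #deg≥1-split : #deg≥ 1 K + #deg≥ 1 R ≤ #deg≥ 1 J
    #deg≥1-split = subst (_≤ #deg≥ 1 J) (∑-distrib-+ (ind K) (ind R)) (∑-mono-≤ pointwise)
      where
      ind : Subset m → Fin n → ℕ
      ind L x = indicator (1 ≤? deg G L x)
      ⊆⇒ind≤ : ∀ {L} → L ⊆ J → ∀ x → ind L x ≤ ind J x
      ⊆⇒ind≤ L⊆J x = indicator-mono (1 ≤? _) (1 ≤? _) λ 1≤ → ≤-trans 1≤ (deg-mono-⊆ L⊆J x)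
      pointwise : ∀ x → ind K x + ind R x ≤ ind J x
      pointwise x with 1 ≤? deg G K x
      ... | yes x∈K = begin
        ind K x + ind R x ≡⟨ cong (ind K x +_) (indicator-no (1 ≤? deg G R x) x∉R) ⟩
        ind K x + 0       ≡⟨ +-identityʳ _ ⟩
        ind K x           ≤⟨ ⊆⇒ind≤ K⊆J x ⟩
        ind J x           ∎
        where
        open ≤-Reasoning
        x∉R = λ x∈R → contradiction (subst (1 ≤_) (Reach⇒deg-R≡0 (isVertex-K⇒Reach {x} x∈K)) x∈R) λ ()
      ... | no x∉K =
        subst (_≤ ind J x) (cong (_+ ind R x) (sym (indicator-no (1 ≤? deg G K x) x∉K))) (⊆⇒ind≤ R⊆J x)

  Dense : Subset m → Set
  Dense J = Nonempty J × #deg≥ 1 J ≤ ∣ J ∣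

  LeaflessSub : Subset m → Subset m → Set
  LeaflessSub J L = L ⊆ J × Nonempty L × Leafless L

  Dense-remove-leaf : ∀ {J e} v → e ∈ J → endsAt G e v ≡ 1 → deg G (J - e) v ≡ 0 →
                      Dense J → Dense (J - e)
  Dense-remove-leaf {J} {e} v e∈J eᵥ≡1 degJ-e-v≡0 (_ , #V≤∣J∣) =
    ∣p∣-positive (+-cancelʳ-≤ 1 1 _ (≤-trans 2≤#V #V≤∣J-e∣+1)) ,
    +-cancelʳ-≤ 1 _ _ (subst (_≤ ∣ J - e ∣ + 1) (+-comm 1 _) (≤-trans #V-decreases #V≤∣J-e∣+1))
    where
    v∈J : IsVertex G J v
    v∈J = ≤-trans (≤-reflexive (sym eᵥ≡1)) (endsAt≤deg e∈J v)
    #V-decreases : #deg≥ 1 (J - e) < #deg≥ 1 J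
    #V-decreases = #deg≥1-remove-leaf J v e∈J v∈J degJ-e-v≡0
    #V≤∣J-e∣+1 : #deg≥ 1 J ≤ ∣ J - e ∣ + 1
    #V≤∣J-e∣+1 = subst (#deg≥ 1 J ≤_) (sym (∣p-x∣+1≡∣p∣ e∈J)) #V≤∣J∣
    2≤#V : 2 ≤ #deg≥ 1 J
    2≤#V with endsAt≡1⇒otherEnd e v eᵥ≡1
    ... | x , x≢v , e-joins = #deg≥1-two J v x (x≢v ∘ sym) v∈J x∈J
      where x∈J = ≤-trans (proj₂ (ends⇒endsAt e-joins)) (endsAt≤deg e∈J x)

  Dense-remove-from-excess : ∀ {J e} → e ∈ J → #deg≥ 1 J < ∣ J ∣ → Dense (J - e)
  Dense-remove-from-excess {J} {e} e∈J #V<∣J∣ =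
    ∣p∣-positive (≤-trans (#deg≥-positive 1 J (end₁ e) (isVertex-end₁ e∈J)) #V≤∣J-e∣) ,
    ≤-trans (#deg≥-mono-⊆ 1 (p─q⊆p J ⁅ e ⁆)) #V≤∣J-e∣
    where
    #V≤∣J-e∣ : #deg≥ 1 J ≤ ∣ J - e ∣
    #V≤∣J-e∣ = +-cancelʳ-≤ 1 _ _ (subst₂ _≤_ (+-comm 1 _) (sym (∣p-x∣+1≡∣p∣ e∈J)) #V<∣J∣)

  Dense⇒leaflessSub : ∀ J → Dense J → Σ[ L ∈ Subset m ] LeaflessSub J L
  Dense⇒leaflessSub = card-rec _ prune
    where
    prune : ∀ J → (∀ {K} → ∣ K ∣ < ∣ J ∣ → Dense K → Σ[ L ∈ Subset m ] LeaflessSub K L) →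
            Dense J → Σ[ L ∈ Subset m ] LeaflessSub J L
    prune J rec dense with any? (λ v → deg G J v ≟ℕ 1)
    ... | no no-leaf = J , id , proj₁ dense , λ v degJv≡1 → no-leaf (v , degJv≡1)
    ... | yes (v , degJv≡1) with leaf-edge J v degJv≡1
    ...   | e , e∈J , eᵥ≡1 , degJ-e-v≡0
      with rec (x∈p⇒∣p-x∣<∣p∣ e∈J) (Dense-remove-leaf v e∈J eᵥ≡1 degJ-e-v≡0 dense)
    ...   | L , L⊆J-e , L-leafless = L , ⊆-trans L⊆J-e (p─q⊆p J ⁅ e ⁆) , L-leafless

  branch⇒excess : ∀ J v → Leafless J → 3 ≤ deg G J v → #deg≥ 1 J < ∣ J ∣
  branch⇒excess J v leafless 3≤deg = ≰⇒> λ ∣J∣≤#V → <-irrefl refl (begin-strict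
    #deg≥ 1 J + #deg≥ 1 J + #deg≥ 3 J ≤⟨ handshake-leafless J leafless ⟩
    ∣ J ∣ + ∣ J ∣                      ≤⟨ +-mono-≤ ∣J∣≤#V ∣J∣≤#V ⟩
    #deg≥ 1 J + #deg≥ 1 J             <⟨ m<m+n _ (#deg≥-positive 3 J v 3≤deg) ⟩
    #deg≥ 1 J + #deg≥ 1 J + #deg≥ 3 J ∎)
    where open ≤-Reasoning

  private
    ≥3 : ∀ d → 1 ≤ d → d ≢ 1 → d ≢ 2 → 3 ≤ d
    ≥3 (suc zero)          _ d≢1 _   = contradiction refl d≢1
    ≥3 (suc (suc zero))    _ _   d≢2 = contradiction refl d≢2
    ≥3 (suc (suc (suc _))) _ _   _   = s≤s (s≤s (s≤s z≤n))

  Minimal : Subset m → Set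
  Minimal J = ∀ {L} → LeaflessSub J L → ∣ J ∣ ≤ ∣ L ∣

  minimal⇒regular : ∀ {J} → Nonempty J → Leafless J → Minimal J → ∀ v → IsVertex G J v → deg G J v ≡ 2
  minimal⇒regular {J} (e , e∈J) leafless minimal v v∈J with deg G J v ≟ℕ 2
  ... | yes degJv≡2 = degJv≡2
  ... | no  degJv≢2
    with Dense⇒leaflessSub (J - e) (Dense-remove-from-excess e∈J
           (branch⇒excess J v leafless (≥3 (deg G J v) v∈J (leafless v) degJv≢2)))
  ... | L , L⊆J-e , neL , lfL = contradiction ∣J∣≤∣J-e∣ (<⇒≱ (x∈p⇒∣p-x∣<∣p∣ e∈J))
    where
    ∣J∣≤∣J-e∣ : ∣ J ∣ ≤ ∣ J - e ∣
    ∣J∣≤∣J-e∣ = ≤-trans (minimal (⊆-trans L⊆J-e (p─q⊆p J ⁅ e ⁆) , neL , lfL)) (p⊆q⇒∣p∣≤∣q∣ L⊆J-e)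

  minimal⇒connected : ∀ {J} → Leafless J → Minimal J → ∀ u v → IsVertex G J u → IsVertex G J v →
                      ¬ ¬ Reach G J u v
  minimal⇒connected {J} leafless minimal u v u∈J v∈J = do
    yes r ← ¬¬-excluded-middle
      where no ¬r → do
              reach? ← ¬¬-∀-Fin (λ g → ¬¬-excluded-middle)
              let open Component J u reach?
              contradiction (minimal (K⊆J , K-nonempty u∈J , K-leafless leafless)) (<⇒≱ (K-smaller v∈J ¬r))
    pure r

  minimal⇒cycle : ∀ {J} → Nonempty J → Leafless J → Minimal J → ¬ ¬ Cycle G J
  minimal⇒cycle {J} ne leafless minimal = do
    connected ← ¬¬-∀-Fin λ u → ¬¬-∀-Fin λ v → ¬¬-→ λ u∈J → ¬¬-→ λ v∈J →
                  minimal⇒connected leafless minimal u v u∈J v∈J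
    pure (ne , minimal⇒regular ne leafless minimal , connected)

  CycleIn : Subset m → Set
  CycleIn J = Σ[ C ∈ Subset m ] C ⊆ J × Cycle G C

  leafless⇒cycle : ∀ J → Nonempty J → Leafless J → ¬ ¬ CycleIn J
  leafless⇒cycle = card-rec _ step
    where
    step : ∀ J → (∀ {K} → ∣ K ∣ < ∣ J ∣ → Nonempty K → Leafless K → ¬ ¬ CycleIn K) →
           Nonempty J → Leafless J → ¬ ¬ CycleIn J
    step J rec ne leafless = do
      no ¬smaller ← ¬¬-excluded-middle {A = Σ[ L ∈ Subset m ] LeaflessSub J L × ∣ L ∣ < ∣ J ∣}
        where yes (L , (L⊆J , neL , lfL) , ∣L∣<∣J∣) → do
                (C , C⊆L , cycle) ← rec ∣L∣<∣J∣ neL lfL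
                pure {A = CycleIn J} (C , ⊆-trans C⊆L L⊆J , cycle)
      cycle ← minimal⇒cycle ne leafless λ sub → ≮⇒≥ λ smaller → ¬smaller (_ , sub , smaller)
      pure {A = CycleIn J} (J , ⊆-refl , cycle)

  Independent⇒component-sparse : ∀ {J u} reach? → Independent G J →
                                  ∣ Component.K J u reach? ∣ ≤ #deg≥ 1 (Component.K J u reach?)
  Independent⇒component-sparse {J} {u} reach? indep =
    decidable-stable (∣ K ∣ ≤? #deg≥ 1 K) λ ¬sparse → two-cycles (≰⇒> ¬sparse) id
    where
    open Component J u reach?
    two-cycles : #deg≥ 1 K < ∣ K ∣ → ¬ ¬ ⊥
    two-cycles excess = do
      let K-dense = ∣p∣-positive (≤-trans (s≤s z≤n) excess) , <⇒≤ excess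
          (L₁ , L₁⊆K , neL₁ , lfL₁) = Dense⇒leaflessSub K K-dense
      (C₁ , C₁⊆L₁ , cycle₁) ← leafless⇒cycle L₁ neL₁ lfL₁
      let (e₁ , e₁∈C₁) = proj₁ cycle₁
          e₁∈K = L₁⊆K (C₁⊆L₁ e₁∈C₁)
          (L₂ , L₂⊆K-e₁ , neL₂ , lfL₂) = Dense⇒leaflessSub (K - e₁) (Dense-remove-from-excess e₁∈K excess)
      (C₂ , C₂⊆L₂ , cycle₂) ← leafless⇒cycle L₂ neL₂ lfL₂
      let (e₂ , e₂∈C₂) = proj₁ cycle₂
          C₂⊆K-e₁ = ⊆-trans C₂⊆L₂ L₂⊆K-e₁
          C₂⊆K = ⊆-trans C₂⊆K-e₁ (p─q⊆p K ⁅ e₁ ⁆)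
      pure (indep C₁ C₂ (⊆-trans C₁⊆L₁ (⊆-trans L₁⊆K K⊆J)) (⊆-trans C₂⊆K K⊆J) cycle₁ cycle₂
                  (λ { refl → x∉p-x K e₁ (C₂⊆K-e₁ e₁∈C₁) })
                  (end₁ e₁) (end₁ e₂) (isVertex-end₁ e₁∈C₁) (isVertex-end₁ e₂∈C₂)
                  (Reach-sym (∈K⇒Reach e₁∈K) ◅◅ ∈K⇒Reach (C₂⊆K e₂∈C₂)))

  Independent⇒sparse : ∀ I → Independent G I → ∣ I ∣ ≤ #deg≥ 1 I
  Independent⇒sparse = card-rec _ step
    where
    step : ∀ I → (∀ {R} → ∣ R ∣ < ∣ I ∣ → Independent G R → ∣ R ∣ ≤ #deg≥ 1 R) →
           Independent G I → ∣ I ∣ ≤ #deg≥ 1 I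
    step I rec indep with ∣ I ∣ ≤? #deg≥ 1 I
    ... | yes sparse = sparse
    ... | no ¬sparse with ∣p∣-positive (≤-trans (s≤s z≤n) (≰⇒> ¬sparse))
    ...   | e , e∈I = contradiction ¬sparse do
      reach? ← ¬¬-∀-Fin λ g → ¬¬-excluded-middle
      let open Component I (end₁ e) reach?
          e∈K = Reach⇒∈K e∈I ε
          ∣R∣<∣I∣ = begin-strict
            ∣ R ∣         <⟨ m<n+m ∣ R ∣ (≤-<-trans z≤n (x∈p⇒∣p-x∣<∣p∣ e∈K)) ⟩
            ∣ K ∣ + ∣ R ∣ ≡⟨ ∣J∣≡∣K∣+∣R∣ ⟨
            ∣ I ∣         ∎
      pure (begin
        ∣ I ∣                  ≡⟨ ∣J∣≡∣K∣+∣R∣ ⟩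
        ∣ K ∣ + ∣ R ∣          ≤⟨ +-mono-≤ (Independent⇒component-sparse reach? indep)
                                          (rec ∣R∣<∣I∣ (Independent-antitone R⊆J indep)) ⟩
        #deg≥ 1 K + #deg≥ 1 R ≤⟨ #deg≥1-split ⟩
        #deg≥ 1 I             ∎)
      where open ≤-Reasoning

  doubleCircuit-#deg≥3≤4 : ∀ {D} → DoubleCircuit G D → #deg≥ 3 D ≤ 4
  doubleCircuit-#deg≥3≤4 {D} dc@(k , ((I , I⊆D , indep , ∣I∣≡k) , _) , k+2≡∣D∣ , _) =
    +-cancelˡ-≤ (#V + #V) _ 4 (begin
      #V + #V + #deg≥ 3 D ≤⟨ handshake-leafless D (doubleCircuit-leafless dc) ⟩
      ∣ D ∣ + ∣ D ∣        ≡⟨ cong₂ _+_ k+2≡∣D∣ k+2≡∣D∣ ⟨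
      (k + 2) + (k + 2)   ≤⟨ +-mono-≤ (+-monoˡ-≤ 2 k≤#V) (+-monoˡ-≤ 2 k≤#V) ⟩
      (#V + 2) + (#V + 2) ≡⟨ rearrange #V ⟩
      #V + #V + 4         ∎)
    where
    open ≤-Reasoning
    #V = #deg≥ 1 D
    k≤#V : k ≤ #V
    k≤#V = begin
      k         ≡⟨ ∣I∣≡k ⟨
      ∣ I ∣      ≤⟨ Independent⇒sparse I indep ⟩
      #deg≥ 1 I ≤⟨ #deg≥-mono-⊆ 1 I⊆D ⟩
      #V        ∎
    rearrange : ∀ a → (a + 2) + (a + 2) ≡ a + a + 4
    rearrange = solve 1 (λ a → (a :+ con 2) :+ (a :+ con 2) := a :+ a :+ con 4) refl
      where open +-*-Solver

lemma7 : ∀ {n m : ℕ} (G : Graph n m) (D : Subset m) → DoubleCircuit G D →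
    (∀ v → deg G D v ≢ 1)
    × numBranch G D ≤ 4
    × (∀ {k} (P : Fin k → Subset m) → IsCircuitPartition G D P →
         ∀ e f → e ∈ D → f ∈ D → SameSubdivisionClass G D e f →
         ∃[ i ] (e ∈ P i × f ∈ P i))
lemma7 G D dc =
  doubleCircuit-leafless G dc ,
  subst (_≤ 4) (sym (numBranch≡#deg≥3 G D)) (doubleCircuit-#deg≥3≤4 G dc) ,
  λ P partition e f e∈D _ same → sameSubdivisionClass⇒sameCircuitClass G partition e∈D same
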